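{- Let $m,n\ge 2$ be integers and $F\subseteq E(K_{m,n})$. Then $S_F$ is a mutual-visibility set of maximum cardinality of $L(K_{m,n})$ if and only if $F$ is a set of edges of maximum cardinality among all $F'\subseteq E(K_{m,n})$ such that $(K_{m,n})_{F'}$ contains no $4$-cycle.
   Context: $L(G)$ denotes the line graph of $G$, with vertex set $\{e_{uv}: uv\in E(G)\}$, $e_{uv}$ and $e_{u'v'}$ adjacent iff the edges share an endpoint. For $F\subseteq E(G)$, $S_F=\{e_{uv}:uv\in F\}$, and $G_F$ is the subgraph of $G$ with edge set $F$ and vertex set the endpoints of edges of $F$. For a connected graph $H$ and $X\subseteq V(H)$, two vertices are $X$-visible if there is a shortest path between them whose internal vertices are not in $X$; $X$ is a mutual-visibility set if every two vertices of $X$ are $X$-visible. -}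

module Defs where

open import Data.Nat using (ℕ; zero; suc; _+_; _≤_)
open import Data.Fin using (Fin)
open import Data.Bool using (Bool; true; false; if_then_else_)
open import Data.List using (List; map; allFin)
open import Data.Nat.ListAction using (sum)
open import Data.Product using (Σ; ∃; ∃-syntax; _×_; _,_)
open import Data.Sum using (_⊎_; inj₁; inj₂)
open import Data.Unit using (⊤)
open import Data.Empty using (⊥)
open import Relation.Binary.PropositionalEquality using (_≡_; _≢_)

module GraphNotions {V : Set} (Adj : V → V → Set) where

  data Walk : V → V → Set where
    []  : ∀ {u} → Walk u u
    _∷_ : ∀ {u w v} → Adj u w → Walk w v → Walk u v

  length : ∀ {u v} → Walk u v → ℕ
  length []      = zero
  length (_ ∷ w) = suc (length w)

  AvoidsFrom : (X : V → Bool) → ∀ {u v} → Walk u v → Set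
  AvoidsFrom X []          = ⊤
  AvoidsFrom X {u} (_ ∷ w) = (X u ≡ false) × AvoidsFrom X w

  InternalAvoid : (X : V → Bool) → ∀ {u v} → Walk u v → Set
  InternalAvoid X []      = ⊤
  InternalAvoid X (_ ∷ w) = AvoidsFrom X w

  Shortest : ∀ {u v} → Walk u v → Set
  Shortest {u} {v} w = (w' : Walk u v) → length w ≤ length w'

  Visible : (X : V → Bool) → V → V → Set
  Visible X u v = Σ (Walk u v) λ w → Shortest w × InternalAvoid X w

  MutualVisibility : (X : V → Bool) → Set
  MutualVisibility X =
    ∀ u v → X u ≡ true → X v ≡ true → Visible X u v

-- The complete bipartite graph K_{m,n}: vertices Fin m ⊎ Fin n, the edge
-- set E(K_{m,n}) is indexed by Fin m × Fin n (pair (i,j) = edge between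
-- left vertex i and right vertex j).

KVertex : ℕ → ℕ → Set
KVertex m n = Fin m ⊎ Fin n

KEdge : ℕ → ℕ → Set
KEdge m n = Fin m × Fin n

Endpoint : ∀ {m n} → KVertex m n → KEdge m n → Set
Endpoint x (i , j) = (x ≡ inj₁ i) ⊎ (x ≡ inj₂ j)

EdgeSet : ℕ → ℕ → Set
EdgeSet m n = KEdge m n → Bool

card : ∀ {m n} → (Fin m × Fin n → Bool) → ℕ
card {m} {n} X =
  sum (map (λ i → sum (map (λ j → if X (i , j) then 1 else 0) (allFin n)))
           (allFin m))

-- Line graph L(K_{m,n}): vertex e_{uv} for each edge uv; two distinct
-- vertices adjacent iff the edges share an endpoint.

LAdj : ∀ {m n} → KEdge m n → KEdge m n → Set
LAdj {m} {n} e e' = (e ≢ e') × ∃[ x ] (Endpoint {m} {n} x e × Endpoint x e')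

module L {m n : ℕ} = GraphNotions (LAdj {m} {n})

-- S_F (vertices of L(K_{m,n}) are indexed by the edges themselves)
S : ∀ {m n} → EdgeSet m n → (KEdge m n → Bool)
S F e = F e

MaxMutualVisibility : ∀ {m n} → (KEdge m n → Bool) → Set
MaxMutualVisibility {m} {n} X =
  L.MutualVisibility {m} {n} X ×
  ((Y : KEdge m n → Bool) → L.MutualVisibility {m} {n} Y → card Y ≤ card X)

FAdj : ∀ {m n} → EdgeSet m n → KVertex m n → KVertex m n → Set
FAdj F (inj₁ i) (inj₂ j) = F (i , j) ≡ true
FAdj F (inj₂ j) (inj₁ i) = F (i , j) ≡ true
FAdj F (inj₁ _) (inj₁ _) = ⊥
FAdj F (inj₂ _) (inj₂ _) = ⊥

HasC4 : ∀ {m n} → EdgeSet m n → Set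
HasC4 {m} {n} F =
  Σ (KVertex m n) λ a → Σ (KVertex m n) λ b →
  Σ (KVertex m n) λ c → Σ (KVertex m n) λ d →
    (a ≢ b) × (a ≢ c) × (a ≢ d) × (b ≢ c) × (b ≢ d) × (c ≢ d) ×
    FAdj F a b × FAdj F b c × FAdj F c d × FAdj F d a

C4Free : ∀ {m n} → EdgeSet m n → Set
C4Free F = HasC4 F → ⊥

MaxC4Free : ∀ {m n} → EdgeSet m n → Set
MaxC4Free {m} {n} F =
  C4Free F × ((F' : EdgeSet m n) → C4Free F' → card F' ≤ card F)

-- L(K_{m,n}) is the m × n rook's graph: the edge (i , j) is the cell in row i
-- and column j, and two cells are adjacent iff they share a row or a column.
-- Its diameter is 2, and two cells in different rows and columns have exactly
-- the two other corners of their rectangle as common neighbours.  Hence they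
-- fail to be X-visible iff all four corners of the rectangle lie in X, and such
-- rectangles are exactly the 4-cycles of (K_{m,n})_F.  So S_F is a
-- mutual-visibility set iff (K_{m,n})_F is C4-free, and the two maximisation
-- problems coincide.
module Submission where

open import Defs
open import Data.Nat using (ℕ; _≤_; z≤n; s≤s)
open import Data.Product using (_×_; _,_; proj₁; proj₂; ∃-syntax)
open import Data.Sum using (_⊎_; inj₁; inj₂)
open import Data.Sum.Properties using (inj₁-injective; inj₂-injective)
open import Data.Fin using (Fin; _≟_)
open import Data.Bool using (true; false)
open import Data.Unit using (tt)
open import Data.Empty using (⊥-elim)
open import Function.Bundles using (_⇔_; mk⇔; Equivalence)
open import Relation.Nullary using (¬_; yes; no)
open import Relation.Binary.PropositionalEquality using (_≡_; _≢_; refl; sym; trans; cong)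

module _ {V : Set} {Adj : V → V → Set} where
  open GraphNotions Adj

  ≢⇒1≤length : ∀ {u v} → u ≢ v → (p : Walk u v) → 1 ≤ length p
  ≢⇒1≤length u≢v []      = ⊥-elim (u≢v refl)
  ≢⇒1≤length _   (_ ∷ _) = s≤s z≤n

  ¬Adj⇒2≤length : ∀ {u v} → u ≢ v → ¬ Adj u v → (p : Walk u v) → 2 ≤ length p
  ¬Adj⇒2≤length u≢v _  []            = ⊥-elim (u≢v refl)
  ¬Adj⇒2≤length _   ¬a (a ∷ [])      = ⊥-elim (¬a a)
  ¬Adj⇒2≤length _   _  (_ ∷ (_ ∷ _)) = s≤s (s≤s z≤n)

  visible-refl : ∀ X u → Visible X u u
  visible-refl X u = [] , (λ _ → z≤n) , tt

  visible-adjacent : ∀ X {u v} → u ≢ v → Adj u v → Visible X u v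
  visible-adjacent X u≢v a = (a ∷ []) , ≢⇒1≤length u≢v , tt

  visible-via : ∀ X {u w v} → u ≢ v → ¬ Adj u v →
    Adj u w → Adj w v → X w ≡ false → Visible X u v
  visible-via X u≢v ¬a a b Xw = (a ∷ (b ∷ [])) , ¬Adj⇒2≤length u≢v ¬a , Xw , tt

  commonNeighbours⊆X⇒¬Visible : ∀ X {u w v} → u ≢ v → ¬ Adj u v →
    Adj u w → Adj w v → (∀ {w′} → Adj u w′ → Adj w′ v → X w′ ≡ true) →
    ¬ Visible X u v
  commonNeighbours⊆X⇒¬Visible X u≢v _ _ _ _ ([] , _) = u≢v refl
  commonNeighbours⊆X⇒¬Visible X _ ¬a _ _ _ (a′ ∷ [] , _) = ¬a a′
  commonNeighbours⊆X⇒¬Visible X _ _ _ _ inX (a′ ∷ (b′ ∷ []) , _ , Xw′ , _)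
    with () ← trans (sym (inX a′ b′)) Xw′
  commonNeighbours⊆X⇒¬Visible X _ _ a b _ (_ ∷ (_ ∷ (_ ∷ _)) , shortest , _)
    with s≤s (s≤s ()) ← shortest (a ∷ (b ∷ []))

module _ {m n : ℕ} where
  open GraphNotions (LAdj {m} {n})

  LAdj⇒sameRow⊎sameColumn : ∀ {i i′ : Fin m} {j j′ : Fin n} →
    LAdj (i , j) (i′ , j′) → i ≡ i′ ⊎ j ≡ j′
  LAdj⇒sameRow⊎sameColumn (_ , _ , inj₁ refl , inj₁ refl) = inj₁ refl
  LAdj⇒sameRow⊎sameColumn (_ , _ , inj₂ refl , inj₂ refl) = inj₂ refl
  LAdj⇒sameRow⊎sameColumn (_ , _ , inj₁ refl , inj₂ ())
  LAdj⇒sameRow⊎sameColumn (_ , _ , inj₂ refl , inj₁ ())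

  sameRow⇒LAdj : ∀ {i : Fin m} {j j′ : Fin n} → j ≢ j′ → LAdj (i , j) (i , j′)
  sameRow⇒LAdj {i} j≢j′ = (λ e → j≢j′ (cong proj₂ e)) , inj₁ i , inj₁ refl , inj₁ refl

  sameColumn⇒LAdj : ∀ {i i′ : Fin m} {j : Fin n} → i ≢ i′ → LAdj (i , j) (i′ , j)
  sameColumn⇒LAdj {j = j} i≢i′ = (λ e → i≢i′ (cong proj₁ e)) , inj₂ j , inj₂ refl , inj₂ refl

  ≢row⇒≢ : ∀ {i i′ : Fin m} {j j′ : Fin n} → i ≢ i′ → (i , j) ≢ (i′ , j′)
  ≢row⇒≢ i≢i′ e = i≢i′ (cong proj₁ e)

  ¬LAdj-diagonal : ∀ {i i′ : Fin m} {j j′ : Fin n} → i ≢ i′ → j ≢ j′ →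
    ¬ LAdj (i , j) (i′ , j′)
  ¬LAdj-diagonal i≢i′ j≢j′ a with LAdj⇒sameRow⊎sameColumn a
  ... | inj₁ i≡i′ = i≢i′ i≡i′
  ... | inj₂ j≡j′ = j≢j′ j≡j′

  commonNeighbour-diagonal : ∀ {i i′ : Fin m} {j j′ : Fin n} {e : KEdge m n} →
    i ≢ i′ → j ≢ j′ → LAdj (i , j) e → LAdj e (i′ , j′) →
    e ≡ (i , j′) ⊎ e ≡ (i′ , j)
  commonNeighbour-diagonal {e = _ , _} i≢i′ j≢j′ a b
    with LAdj⇒sameRow⊎sameColumn a | LAdj⇒sameRow⊎sameColumn b
  ... | inj₁ refl | inj₁ refl = ⊥-elim (i≢i′ refl)
  ... | inj₁ refl | inj₂ refl = inj₁ refl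
  ... | inj₂ refl | inj₁ refl = inj₂ refl
  ... | inj₂ refl | inj₂ refl = ⊥-elim (j≢j′ refl)

  Rectangle : EdgeSet m n → Set
  Rectangle F = ∃[ i ] ∃[ i′ ] ∃[ j ] ∃[ j′ ] i ≢ i′ × j ≢ j′ ×
    F (i , j) ≡ true × F (i , j′) ≡ true × F (i′ , j) ≡ true × F (i′ , j′) ≡ true

  HasC4⇒Rectangle : ∀ {F} → HasC4 F → Rectangle F
  HasC4⇒Rectangle (inj₁ i , inj₂ j , inj₁ i′ , inj₂ j′ , _ , a≢c , _ , _ , b≢d , _ , ab , bc , cd , da) =
    i , i′ , j , j′ , (λ e → a≢c (cong inj₁ e)) , (λ e → b≢d (cong inj₂ e)) , ab , da , bc , cd
  HasC4⇒Rectangle (inj₂ j , inj₁ i , inj₂ j′ , inj₁ i′ , _ , a≢c , _ , _ , b≢d , _ , ab , bc , cd , da) =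
    i , i′ , j , j′ , (λ e → b≢d (cong inj₁ e)) , (λ e → a≢c (cong inj₂ e)) , ab , bc , da , cd
  HasC4⇒Rectangle (inj₁ _ , inj₁ _ , _ , _ , _ , _ , _ , _ , _ , _ , () , _)
  HasC4⇒Rectangle (inj₂ _ , inj₂ _ , _ , _ , _ , _ , _ , _ , _ , _ , () , _)
  HasC4⇒Rectangle (inj₁ _ , inj₂ _ , inj₂ _ , _ , _ , _ , _ , _ , _ , _ , _ , () , _)
  HasC4⇒Rectangle (inj₂ _ , inj₁ _ , inj₁ _ , _ , _ , _ , _ , _ , _ , _ , _ , () , _)
  HasC4⇒Rectangle (inj₁ _ , inj₂ _ , inj₁ _ , inj₁ _ , _ , _ , _ , _ , _ , _ , _ , _ , () , _)
  HasC4⇒Rectangle (inj₂ _ , inj₁ _ , inj₂ _ , inj₂ _ , _ , _ , _ , _ , _ , _ , _ , _ , () , _)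

  Rectangle⇒HasC4 : ∀ {F} → Rectangle F → HasC4 F
  Rectangle⇒HasC4 (i , i′ , j , j′ , i≢i′ , j≢j′ , Fij , Fij′ , Fi′j , Fi′j′) =
    inj₁ i , inj₂ j , inj₁ i′ , inj₂ j′ ,
    (λ ()) , (λ e → i≢i′ (inj₁-injective e)) , (λ ()) ,
    (λ ()) , (λ e → j≢j′ (inj₂-injective e)) , (λ ()) ,
    Fij , Fi′j , Fi′j′ , Fij′

  MutualVisibility⇒¬Rectangle : ∀ X → MutualVisibility X → ¬ Rectangle X
  MutualVisibility⇒¬Rectangle X mv (i , i′ , j , j′ , i≢i′ , j≢j′ , Xij , Xij′ , Xi′j , Xi′j′) =
    commonNeighbours⊆X⇒¬Visible X (≢row⇒≢ i≢i′) (¬LAdj-diagonal i≢i′ j≢j′)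
      (sameRow⇒LAdj j≢j′) (sameColumn⇒LAdj i≢i′) cornersInX
      (mv (i , j) (i′ , j′) Xij Xi′j′)
    where
    cornersInX : ∀ {e} → LAdj (i , j) e → LAdj e (i′ , j′) → X e ≡ true
    cornersInX a b with commonNeighbour-diagonal i≢i′ j≢j′ a b
    ... | inj₁ refl = Xij′
    ... | inj₂ refl = Xi′j

  ¬Rectangle⇒MutualVisibility : ∀ X → ¬ Rectangle X → MutualVisibility X
  ¬Rectangle⇒MutualVisibility X noRect (i , j) (i′ , j′) Xij Xi′j′ with i ≟ i′ | j ≟ j′
  ... | yes refl | yes refl = visible-refl X (i , j)
  ... | yes refl | no j≢j′  = visible-adjacent X (λ e → j≢j′ (cong proj₂ e)) (sameRow⇒LAdj j≢j′)
  ... | no i≢i′  | yes refl = visible-adjacent X (≢row⇒≢ i≢i′) (sameColumn⇒LAdj i≢i′)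
  ... | no i≢i′  | no j≢j′  with X (i , j′) in Xij′ | X (i′ , j) in Xi′j
  ...   | false | _     = visible-via X (≢row⇒≢ i≢i′) (¬LAdj-diagonal i≢i′ j≢j′)
                            (sameRow⇒LAdj j≢j′) (sameColumn⇒LAdj i≢i′) Xij′
  ...   | true  | false = visible-via X (≢row⇒≢ i≢i′) (¬LAdj-diagonal i≢i′ j≢j′)
                            (sameColumn⇒LAdj i≢i′) (sameRow⇒LAdj j≢j′) Xi′j
  ...   | true  | true  = ⊥-elim (noRect (i , i′ , j , j′ , i≢i′ , j≢j′ , Xij , Xij′ , Xi′j , Xi′j′))

  MutualVisibility⇔C4Free : ∀ X → MutualVisibility X ⇔ C4Free X
  MutualVisibility⇔C4Free X = mk⇔
    (λ mv c4 → MutualVisibility⇒¬Rectangle X mv (HasC4⇒Rectangle c4))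
    (λ c4Free → ¬Rectangle⇒MutualVisibility X (λ r → c4Free (Rectangle⇒HasC4 r)))

  Maximum : (EdgeSet m n → Set) → EdgeSet m n → Set
  Maximum P X = P X × (∀ Y → P Y → card Y ≤ card X)

  Maximum-resp-⇔ : ∀ {P Q} → (∀ X → P X ⇔ Q X) → ∀ X → Maximum P X ⇔ Maximum Q X
  Maximum-resp-⇔ P⇔Q X = mk⇔
    (λ (PX , max) → Equivalence.to (P⇔Q X) PX , λ Y QY → max Y (Equivalence.from (P⇔Q Y) QY))
    (λ (QX , max) → Equivalence.from (P⇔Q X) QX , λ Y PY → max Y (Equivalence.to (P⇔Q Y) PY))

theorem3p13 : (m n : ℕ) → 2 ≤ m → 2 ≤ n → (F : EdgeSet m n) →
    (MaxMutualVisibility (S F) → MaxC4Free F) × (MaxC4Free F → MaxMutualVisibility (S F))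
theorem3p13 m n _ _ F = Equivalence.to maximum⇔ , Equivalence.from maximum⇔
  where
  maximum⇔ : Maximum L.MutualVisibility F ⇔ Maximum C4Free F
  maximum⇔ = Maximum-resp-⇔ MutualVisibility⇔C4Free F
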